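{- Let $(G,\prec)$ be a Nyldon-like set over $A$ and let $w\in A^+$. Then $w$ has exactly one $G$-factorization, and the following procedure outputs it. Maintain a list of blocks, initially the letters of $w$ in order, and an initially empty output list. While the list of blocks is nonempty: if the first block is $\prec$-minimal among the current blocks, remove it from the list and append it to the output; otherwise, take the leftmost occurrence $u$ of a $\prec$-minimal current block (which then has a left neighbour $v\succ u$) and replace the two adjacent blocks $v,u$ by the single block $vu$. The output list is the $G$-factorization of $w$.
   Context: $A$ is a finite alphabet with at least two letters. For $w\in A^+$, a $G$-factorization of $w$ is a sequence $(w_1,\dots,w_k)$, $k\ge 1$, of words of $G$ with $w=w_1w_2\cdots w_k$ and $w_1\preceq w_2\preceq\cdots\preceq w_k$. A Nyldon-like set is a pair $(G,\prec)$ with $G\subseteq A^+$ and $\prec$ a total order on $G$ such that: every letter of $A$ lies in $G$; a word $w$ of length at least $2$ lies in $G$ if and only if $w$ has no $G$-factorization with $k\ge 2$ factors; and for all $f,g\in G$ with $fg\in G$ we have $f\prec fg$. (All blocks arising in the procedure are elements of $G$, so comparing them with $\prec$ makes sense.) -}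

module Defs where

open import Data.Nat using (ℕ; _≤_)
open import Data.Fin using (Fin)
open import Data.List using (List; []; _∷_; [_]; _++_; concat; length; map)
open import Data.List.Relation.Unary.All using (All)
open import Data.List.Relation.Unary.Linked using (Linked)
open import Data.Product using (Σ; _×_; ∃)
open import Data.Sum using (_⊎_)
open import Relation.Nullary using (¬_)
open import Relation.Binary using (Tri)
open import Relation.Binary.PropositionalEquality using (_≡_; _≢_)
open import Function.Bundles using (_⇔_)

Word : ℕ → Set
Word n = List (Fin n)

Refl : {X : Set} → (X → X → Set) → X → X → Set
Refl _<_ x y = (x < y) ⊎ (x ≡ y)

record IsGFact {n : ℕ} (G : Word n → Set) (_≺_ : Word n → Word n → Set)
               (w : Word n) (fs : List (Word n)) : Set where
  field
    nonempty  : fs ≢ []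
    inG       : All G fs
    product   : concat fs ≡ w
    sorted    : Linked (Refl _≺_) fs

record NyldonLike (n : ℕ) : Set₁ where
  field
    G        : Word n → Set
    _≺_      : Word n → Word n → Set
    G-nonempty : ∀ {w} → G w → w ≢ []
    ≺-tri    : ∀ {f g} → G f → G g → Tri (f ≺ g) (f ≡ g) (g ≺ f)
    ≺-trans  : ∀ {f g h} → G f → G g → G h → f ≺ g → g ≺ h → f ≺ h
    letters  : ∀ (a : Fin n) → G [ a ]
    charact  : ∀ (w : Word n) → 2 ≤ length w →
               G w ⇔ (¬ Σ (List (Word n)) λ fs → IsGFact G _≺_ w fs × 2 ≤ length fs)
    prefix   : ∀ {f g} → G f → G g → G (f ++ g) → f ≺ (f ++ g)

module Procedure {n : ℕ} (NL : NyldonLike n) where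
  open NyldonLike NL

  Minimal : Word n → List (Word n) → Set
  Minimal b bs = All (λ y → ¬ (y ≺ b)) bs

  data Step : List (Word n) × List (Word n) → List (Word n) × List (Word n) → Set where
    emit  : ∀ {b bs out} → Minimal b (b ∷ bs) →
            Step (b ∷ bs Data.Product., out) (bs Data.Product., out ++ [ b ])
    merge : ∀ {pre v u post out} →
            Minimal u (pre ++ v ∷ u ∷ post) →
            All (λ y → ¬ Minimal y (pre ++ v ∷ u ∷ post)) (pre ++ [ v ]) →
            Step (pre ++ v ∷ u ∷ post Data.Product., out)
                 (pre ++ (v ++ u) ∷ post Data.Product., out)

  data Run : List (Word n) → List (Word n) → List (Word n) → Set where
    done : ∀ {out} → Run [] out out
    step : ∀ {bs out bs' out' final} →
           Step (bs Data.Product., out) (bs' Data.Product., out') →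
           Run bs' out' final → Run bs out final

  Outputs : Word n → List (Word n) → Set
  Outputs w fs = Run (map [_] w) [] fs

-- Write ⪯ for the reflexive closure of ≺. Two facts about G, proved together by
-- induction on length, drive everything: the last factor of a G-factorization of w
-- is the longest suffix of w lying in G, and a proper suffix in G of a word of G is
-- smaller than it. The first makes factorizations unique: two factorizations of w
-- share their last factor, hence all factors.
--
-- In the procedure every block stays in G. A block v is a x₁ ⋯ xₖ for a letter a
-- and x₁ ⪯ ⋯ ⪯ xₖ ⪯ u for every block u to its right: each xᵢ was minimal when
-- appended, and merging only makes blocks larger (f ≺ fg). When v is merged with
-- the minimal block u ≺ v, a factorization of vu with two or more factors would end
-- in the longest G-suffix of vu, which is either u (forcing v ⪯ u) or x u for a
-- proper suffix x of v, and the shape of v together with the two facts excludes this.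
-- Emitted blocks are minimal, so the output is nondecreasing and below all
-- remaining blocks; each step removes one block, so the procedure terminates and
-- outputs a G-factorization of w.
--
-- From the characterisation of G one only obtains factorizations in double-negated
-- form; this suffices since they are used only for negative or decidable goals.

module Submission where

open import Defs
open import Data.Nat using (ℕ; zero; suc; _≤_; _<_; z≤n; s≤s)
open import Data.Nat.Properties using (≤-refl; ≤-pred; <-≤-trans; ≤-<-trans; suc-injective)
open import Data.List using (List; []; _∷_; [_]; _++_; concat; length; map)
open import Data.List.Properties
  using (++-assoc; ++-cancelʳ; ++-identityʳ; ++-identityˡ-unique; ++-conicalˡ; ++-conicalʳ; ∷-injective;
         length-++-≤ʳ; length-++-sucʳ; concat-++; concat-map-[_])
open import Data.List.Relation.Unary.All as All using (All; []; _∷_)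
open import Data.List.Relation.Unary.All.Properties using (++⁺; ++⁻; ++⁻ʳ; map⁺)
open import Data.List.Relation.Unary.AllPairs as AllPairs using (AllPairs; []; _∷_)
import Data.List.Relation.Unary.AllPairs.Properties as AllPairsₚ
open import Data.List.Relation.Unary.Any as Any using (Any; here; there)
open import Data.List.Relation.Unary.Linked using (Linked; [-]; _∷_)
open import Data.List.Relation.Unary.Linked.Properties using (AllPairs⇒Linked)
open import Data.List.Membership.Propositional using (_∈_)
open import Data.Product using (Σ; _×_; ∃; ∃₂; _,_; proj₁; proj₂)
open import Data.Sum using (_⊎_; inj₁; inj₂)
open import Data.Empty using (⊥; ⊥-elim)
open import Relation.Nullary using (¬_; Dec; yes; no; ¬?)
open import Relation.Nullary.Decidable using (map′; _×-dec_)
open import Relation.Binary using (tri<; tri≈; tri>)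
open import Relation.Binary.PropositionalEquality using (_≡_; _≢_; refl; sym; trans; cong; cong₂; subst; module ≡-Reasoning)
open import Function.Bundles using (Equivalence)

module _ {A : Set} where

  _IsSuffixOf_ : List A → List A → Set
  s IsSuffixOf w = ∃ λ r → w ≡ r ++ s

  IsSuffixOf-antisym : ∀ {s w} → s IsSuffixOf w → w IsSuffixOf s → s ≡ w
  IsSuffixOf-antisym {s} ([] , w≡s) _ = sym w≡s
  IsSuffixOf-antisym {s} (c ∷ r , refl) (r′ , s≡r′crs)
    with ++-identityˡ-unique (r′ ++ c ∷ r) (trans s≡r′crs (sym (++-assoc r′ (c ∷ r) s)))
  ... | r′cr≡[] with ++-conicalʳ r′ (c ∷ r) r′cr≡[]
  ... | ()

  ++-split : ∀ (p s q t : List A) → p ++ s ≡ q ++ t →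
             (∃ λ r → q ≡ p ++ r × s ≡ r ++ t) ⊎ (∃ λ r → p ≡ q ++ r × t ≡ r ++ s)
  ++-split []      s q       t e = inj₁ (q , refl , e)
  ++-split (x ∷ p) s []      t e = inj₂ (x ∷ p , refl , sym e)
  ++-split (x ∷ p) s (y ∷ q) t e with ∷-injective e
  ... | refl , e′ with ++-split p s q t e′
  ... | inj₁ (r , q≡pr , s≡rt) = inj₁ (r , cong (x ∷_) q≡pr , s≡rt)
  ... | inj₂ (r , p≡qr , t≡rs) = inj₂ (r , cong (x ∷_) p≡qr , t≡rs)

  length-++-<ˡ : ∀ (xs : List A) {ys} → ys ≢ [] → length xs < length (xs ++ ys)
  length-++-<ˡ []       {[]}    ys≢[] = ⊥-elim (ys≢[] refl)
  length-++-<ˡ []       {_ ∷ _} _     = s≤s z≤n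
  length-++-<ˡ (_ ∷ xs)         ys≢[] = s≤s (length-++-<ˡ xs ys≢[])

  length-++-<ʳ : ∀ {xs} (ys : List A) → xs ≢ [] → length ys < length (xs ++ ys)
  length-++-<ʳ {[]}     _  xs≢[] = ⊥-elim (xs≢[] refl)
  length-++-<ʳ {_ ∷ xs} ys _     = s≤s (length-++-≤ʳ ys {xs})

  length-++-<ʳ-assoc : ∀ {xs} (ys : List A) {zs} → xs ≢ [] → length (ys ++ zs) < length ((xs ++ ys) ++ zs)
  length-++-<ʳ-assoc {xs} ys {zs} xs≢[] =
    subst (λ w → length (ys ++ zs) < length w) (sym (++-assoc xs ys zs)) (length-++-<ʳ (ys ++ zs) xs≢[])

  2≤length-++ : ∀ {xs ys : List A} → xs ≢ [] → ys ≢ [] → 2 ≤ length (xs ++ ys)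
  2≤length-++ {xs} {ys} xs≢[] ys≢[] = <-≤-trans (s≤s (length-++-<ˡ [] ys≢[])) (length-++-<ʳ ys xs≢[])

  All-merge : ∀ {P : A → Set} pre {v u z post} → All P (pre ++ v ∷ u ∷ post) → P z →
              All P (pre ++ z ∷ post)
  All-merge pre ps pz with ++⁻ pre ps
  ... | ps₁ , _ ∷ _ ∷ ps₂ = ++⁺ ps₁ (pz ∷ ps₂)

  AllPairs-merge : ∀ {R : A → A → Set} pre {v u z post} → AllPairs R (pre ++ v ∷ u ∷ post) →
                   (∀ {x} → R x v → R x z) → All (R z) post → AllPairs R (pre ++ z ∷ post)
  AllPairs-merge []        (_ ∷ _ ∷ rs) _ rz  = rz ∷ rs
  AllPairs-merge (x ∷ pre) (rx ∷ rs)    f rz with ++⁻ʳ pre rx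
  ... | rxv ∷ _ = All-merge pre rx (f rxv) ∷ AllPairs-merge pre rs f rz

  AllPairs-++⁻ʳ : ∀ {R : A → A → Set} pre {xs} → AllPairs R (pre ++ xs) → AllPairs R xs
  AllPairs-++⁻ʳ []        rs       = rs
  AllPairs-++⁻ʳ (_ ∷ pre) (_ ∷ rs) = AllPairs-++⁻ʳ pre rs

  concat-merge : ∀ (pre : List (List A)) {v u post} →
                 concat (pre ++ (v ++ u) ∷ post) ≡ concat (pre ++ v ∷ u ∷ post)
  concat-merge []        {v} {u} {post} = ++-assoc v u (concat post)
  concat-merge (x ∷ pre)                = cong (x ++_) (concat-merge pre)

  length-merge : ∀ (pre : List (List A)) {v u post} →
                 length (pre ++ v ∷ u ∷ post) ≡ suc (length (pre ++ (v ++ u) ∷ post))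
  length-merge pre {v} {u} {post} =
    trans (length-++-sucʳ pre v (u ∷ post))
          (cong suc (trans (length-++-sucʳ pre u post) (sym (length-++-sucʳ pre (v ++ u) post))))

module NyldonTheory {n : ℕ} (NL : NyldonLike n) where
  open NyldonLike NL

  W : Set
  W = Word n

  _⪯_ : W → W → Set
  _⪯_ = Refl _≺_

  ≺-irrefl : ∀ {f} → G f → ¬ f ≺ f
  ≺-irrefl gf f≺f with ≺-tri gf gf
  ... | tri< _ _ ¬c = ¬c f≺f
  ... | tri≈ ¬a _ _ = ¬a f≺f
  ... | tri> ¬a _ _ = ¬a f≺f

  ⊀⇒⪰ : ∀ {f g} → G f → G g → ¬ g ≺ f → f ⪯ g
  ⊀⇒⪰ gf gg g⊀f with ≺-tri gf gg
  ... | tri< a _ _ = inj₁ a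
  ... | tri≈ _ b _ = inj₂ b
  ... | tri> _ _ c = ⊥-elim (g⊀f c)

  ⋠⇒≻ : ∀ {f g} → G f → G g → ¬ f ⪯ g → g ≺ f
  ⋠⇒≻ gf gg f⋠g with ≺-tri gf gg
  ... | tri< a _ _ = ⊥-elim (f⋠g (inj₁ a))
  ... | tri≈ _ b _ = ⊥-elim (f⋠g (inj₂ b))
  ... | tri> _ _ c = c

  ≺-stable : ∀ {f g} → G f → G g → ¬ ¬ f ≺ g → f ≺ g
  ≺-stable gf gg ¬¬f≺g with ≺-tri gf gg
  ... | tri< a  _ _ = a
  ... | tri≈ ¬a _ _ = ⊥-elim (¬¬f≺g ¬a)
  ... | tri> ¬a _ _ = ⊥-elim (¬¬f≺g ¬a)

  ≺-dec : ∀ {f g} → G f → G g → Dec (f ≺ g)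
  ≺-dec gf gg with ≺-tri gf gg
  ... | tri< a  _ _ = yes a
  ... | tri≈ ¬a _ _ = no ¬a
  ... | tri> ¬a _ _ = no ¬a

  ⪯-≺-trans : ∀ {f g h} → G f → G g → G h → f ⪯ g → g ≺ h → f ≺ h
  ⪯-≺-trans gf gg gh (inj₁ f≺g) g≺h = ≺-trans gf gg gh f≺g g≺h
  ⪯-≺-trans _  _  _  (inj₂ refl) g≺h = g≺h

  ≺-⪯-trans : ∀ {f g h} → G f → G g → G h → f ≺ g → g ⪯ h → f ≺ h
  ≺-⪯-trans gf gg gh f≺g (inj₁ g≺h) = ≺-trans gf gg gh f≺g g≺h
  ≺-⪯-trans _  _  _  f≺g (inj₂ refl) = f≺g

  ⪯⇒⊁ : ∀ {f g} → G f → G g → f ⪯ g → ¬ g ≺ f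
  ⪯⇒⊁ gf gg f⪯g g≺f = ≺-irrefl gg (≺-⪯-trans gg gf gg g≺f f⪯g)

  -- The word is constrained by an equation rather than an index so that one can
  -- match on factorizations of compound words such as p ++ s.
  data Fact : W → W → Set where
    single : ∀ {w t} → G t → w ≡ t → Fact w t
    extend : ∀ {w u s t} → Fact u s → G t → s ⪯ t → w ≡ u ++ t → Fact w t

  factors : ∀ {w t} → Fact w t → List W
  factors (single {t = t} _ _)   = [ t ]
  factors (extend {t = t} f _ _ _) = factors f ++ [ t ]

  first-factor : ∀ {w t} → Fact w t → W
  first-factor (single {t = t} _ _) = t
  first-factor (extend f _ _ _)     = first-factor f

  factors-head : ∀ {w t} (f : Fact w t) → ∃ λ hs → factors f ≡ first-factor f ∷ hs
  factors-head (single _ _) = [] , refl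
  factors-head (extend {t = t} f _ _ _) with factors-head f
  ... | hs , e = hs ++ [ t ] , cong (_++ [ t ]) e

  last-in-G : ∀ {w t} → Fact w t → G t
  last-in-G (single gt _)     = gt
  last-in-G (extend _ gt _ _) = gt

  last-suffix : ∀ {w t} → Fact w t → t IsSuffixOf w
  last-suffix (single _ e)             = [] , e
  last-suffix (extend {u = u} _ _ _ e) = u , e

  last-length : ∀ {w t} → Fact w t → length t ≤ length w
  last-length f with last-suffix f
  ... | u , refl = length-++-≤ʳ _ {u}

  fact-nonempty : ∀ {w t} → Fact w t → w ≢ []
  fact-nonempty f w≡[] with last-suffix f
  ... | u , e = G-nonempty (last-in-G f) (++-conicalʳ u _ (trans (sym e) w≡[]))

  prepend : ∀ {f w t} → G f → (fact : Fact w t) → f ⪯ first-factor fact →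
            Σ (Fact (f ++ w) t) λ fact′ → factors fact′ ≡ f ∷ factors fact
  prepend {f} gf (single gt e) f⪯t = extend (single gf refl) gt f⪯t (cong (f ++_) e) , refl
  prepend {f} gf (extend {u = u} {t = t} fact gt s⪯t e) f⪯first with prepend gf fact f⪯first
  ... | fact′ , e′ =
    extend fact′ gt s⪯t (trans (cong (f ++_) e) (sym (++-assoc f u t))) , cong (_++ [ t ]) e′

  sorted⇒Fact : ∀ fs → fs ≢ [] → All G fs → Linked _⪯_ fs →
                ∃ λ t → Σ (Fact (concat fs) t) λ fact → factors fact ≡ fs
  sorted⇒Fact []               fs≢[] _          _ = ⊥-elim (fs≢[] refl)
  sorted⇒Fact (f ∷ [])         _     (gf ∷ [])  _ = f , single gf (++-identityʳ f) , refl
  sorted⇒Fact (f ∷ g ∷ gs) _     (gf ∷ ggs) (f⪯g ∷ sorted)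
    with sorted⇒Fact (g ∷ gs) (λ ()) ggs sorted
  ... | t , fact , factors≡ggs with factors-head fact
  ... | _ , factors≡first∷ with ∷-injective (trans (sym factors≡first∷) factors≡ggs)
  ... | first≡g , _ with prepend gf fact (subst (f ⪯_) (sym first≡g) f⪯g)
  ... | fact′ , e = t , fact′ , trans e (cong (f ∷_) factors≡ggs)

  IsGFact⇒Fact : ∀ {w fs} → IsGFact G _≺_ w fs → ∃ λ t → Σ (Fact w t) λ fact → factors fact ≡ fs
  IsGFact⇒Fact isg with sorted⇒Fact _ (IsGFact.nonempty isg) (IsGFact.inG isg) (IsGFact.sorted isg)
  ... | t , fact , e rewrite IsGFact.product isg = t , fact , e

  factors-sorted-++ : ∀ {w t} (fact : Fact w t) {ys} → Linked _⪯_ (t ∷ ys) →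
                      Linked _⪯_ (factors fact ++ ys)
  factors-sorted-++ (single _ _) sorted = sorted
  factors-sorted-++ (extend {t = t} fact _ s⪯t _) {ys} sorted
    rewrite ++-assoc (factors fact) [ t ] ys = factors-sorted-++ fact (s⪯t ∷ sorted)

  factors-concat : ∀ {w t} (fact : Fact w t) → concat (factors fact) ≡ w
  factors-concat (single {t = t} _ e) = trans (++-identityʳ t) (sym e)
  factors-concat (extend {w} {u} {t = t} fact _ _ e) = begin
    concat (factors fact ++ [ t ])       ≡⟨ concat-++ (factors fact) [ t ] ⟨
    concat (factors fact) ++ (t ++ [])   ≡⟨ cong₂ _++_ (factors-concat fact) (++-identityʳ t) ⟩
    u ++ t                               ≡⟨ e ⟨
    w                                    ∎
    where open ≡-Reasoning

  Fact⇒IsGFact : ∀ {w t} (fact : Fact w t) → IsGFact G _≺_ w (factors fact)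
  Fact⇒IsGFact fact = record
    { nonempty = λ e → case-nonempty (proj₂ (factors-head fact)) e
    ; inG      = factors-in-G fact
    ; product  = factors-concat fact
    ; sorted   = subst (Linked _⪯_) (++-identityʳ (factors fact)) (factors-sorted-++ fact [-])
    }
    where
      case-nonempty : ∀ {xs : List W} {x hs} → xs ≡ x ∷ hs → xs ≢ []
      case-nonempty refl ()
      factors-in-G : ∀ {w t} (fact : Fact w t) → All G (factors fact)
      factors-in-G (single gt _)        = gt ∷ []
      factors-in-G (extend fact gt _ _) = ++⁺ (factors-in-G fact) (gt ∷ [])

  G-irreducible : ∀ {u s t} → G (u ++ t) → Fact u s → G t → s ⪯ t → ⊥
  G-irreducible {u} {t = t} gut fact gt s⪯t =
    Equivalence.to (charact (u ++ t) (2≤length-++ (fact-nonempty fact) (G-nonempty gt))) gut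
      (factors fact′ , Fact⇒IsGFact fact′ , two-factors)
    where
      fact′ : Fact (u ++ t) t
      fact′ = extend fact gt s⪯t refl
      two-factors : 2 ≤ length (factors fact ++ [ t ])
      two-factors with factors-head fact
      ... | hs , e rewrite e = s≤s (length-++-≤ʳ [ t ] {hs})

  last-factor-≻ : ∀ {u s t} → G (u ++ t) → Fact u s → G t → t ≺ s
  last-factor-≻ gut fact gt = ⋠⇒≻ (last-in-G fact) gt (G-irreducible gut fact gt)

  G-fact-trivial : ∀ {g t} → G g → Fact g t → t ≡ g
  G-fact-trivial _  (single _ e)             = sym e
  G-fact-trivial gg (extend fact gt s⪯t refl) = ⊥-elim (G-irreducible gg fact gt s⪯t)

  G-prefix-⪯-last : ∀ {g t} → G g → Fact (g ++ t) t → g ⪯ t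
  G-prefix-⪯-last {g} gg (single _ e) = ⊥-elim (G-nonempty gg (++-identityˡ-unique g (sym e)))
  G-prefix-⪯-last {g} {t} gg (extend {u = u} fact _ s⪯t e) with ++-cancelʳ t u g (sym e)
  ... | refl with G-fact-trivial gg fact
  ... | refl = s⪯t

  fact-exists : ∀ {w} → w ≢ [] → ¬ ¬ (∃ λ t → Fact w t)
  fact-exists {[]}          w≢[] _     = w≢[] refl
  fact-exists {a ∷ []}      _    ¬fact = ¬fact ([ a ] , single (letters a) refl)
  fact-exists {w@(_ ∷ _ ∷ _)} _  ¬fact =
    ¬fact (w , single (Equivalence.from (charact w (s≤s (s≤s z≤n))) no-proper-fact) refl)
    where
      no-proper-fact : ¬ Σ (List W) λ fs → IsGFact G _≺_ w fs × 2 ≤ length fs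
      no-proper-fact (_ , isg , _) with IsGFact⇒Fact isg
      ... | t , fact , _ = ¬fact (t , fact)

  SuffixesSmaller : ℕ → ℕ → Set
  SuffixesSmaller N M = ∀ {f p s} → length p ≤ M → length f < N →
                        G f → f ≡ p ++ s → p ≢ [] → G s → s ≺ f

  -- Joint induction on word length: both facts at N use both facts below N, and
  -- suffix-≺ at N also recurses on the prefix length M.
  record Below (N : ℕ) : Set where
    field
      longest-suffix : ∀ {w t g} → length w < N → Fact w t → G g → g IsSuffixOf w → g IsSuffixOf t
      suffix-≺       : ∀ {M} → SuffixesSmaller N M

  suffix-⪯ᴺ : ∀ {N w s} → Below N → length w < N → G w → G s → s IsSuffixOf w → s ⪯ w
  suffix-⪯ᴺ _  _  _  _  ([] , refl)    = inj₂ refl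
  suffix-⪯ᴺ ih lt gw gs (_ ∷ _ , refl) = inj₁ (Below.suffix-≺ ih ≤-refl lt gw refl (λ ()) gs)

  overlap-impossible : ∀ {N p x s t tx} → Below N → length (p ++ x) < N → Fact (p ++ x) s →
                       G t → s ⪯ t → G (x ++ t) → Fact x tx → ⊥
  overlap-impossible {p = p} ih lt fact gt s⪯t gxt factx with last-suffix factx
  ... | z , refl = ⪯⇒⊁ gs gt s⪯t (≺-⪯-trans gt gtx gs (last-factor-≻ gxt factx gt) tx⪯s)
    where
      gs  = last-in-G fact
      gtx = last-in-G factx
      tx⪯s = suffix-⪯ᴺ ih (≤-<-trans (last-length fact) lt) gs gtx
               (Below.longest-suffix ih lt fact gtx (p ++ z , sym (++-assoc p z _)))

  longest-suffix-step : ∀ {N w t g} → Below N → length w < suc N → Fact w t → G g →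
                        g IsSuffixOf w → g IsSuffixOf t
  longest-suffix-step _ _ (single _ refl) _ g⊑w = g⊑w
  longest-suffix-step {g = g} ih lt (extend {u = u} {t = t} fact gt s⪯t refl) gg (q , e)
    with ++-split q g u t (sym e)
  ... | inj₂ (r , _ , t≡rg)          = r , t≡rg
  ... | inj₁ ([] , _ , g≡t)          = [] , sym g≡t
  ... | inj₁ (c ∷ r , refl , refl) =
    ⊥-elim (fact-exists {c ∷ r} (λ ()) λ (_ , factx) → overlap-impossible ih lt′ fact gt s⪯t gg factx)
    where
      lt′ : length (q ++ c ∷ r) < _
      lt′ = <-≤-trans (length-++-<ˡ (q ++ c ∷ r) (G-nonempty gt)) (≤-pred lt)

  suffix-≺-extend : ∀ {N M p′ tp s ty} → Below N → SuffixesSmaller (suc N) M →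
                    length (p′ ++ tp) ≤ suc M → length ((p′ ++ tp) ++ s) < suc N →
                    length (tp ++ s) < N → G ((p′ ++ tp) ++ s) → p′ ≢ [] → G tp → G s →
                    s ≺ tp → Fact (tp ++ s) ty → s ≺ ((p′ ++ tp) ++ s)
  suffix-≺-extend {N} {M} {p′} {tp} {s} ih ih′ lp lt tps<N gf p′≢[] gtp gs s≺tp facty
    with Below.longest-suffix ih tps<N facty gs (tp , refl)
  ... | [] , refl = ⊥-elim (⪯⇒⊁ gtp gs (G-prefix-⪯-last gtp facty) s≺tp)
  ... | c ∷ r , refl with last-suffix facty
  ... | y₀ , e with ++-cancelʳ s tp (y₀ ++ c ∷ r) (trans e (sym (++-assoc y₀ (c ∷ r) s)))
  ... | refl = ≺-trans gs gty gf s≺ty ty≺f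
    where
      gty : G (c ∷ r ++ s)
      gty = last-in-G facty
      ty<N : length (c ∷ r ++ s) < N
      ty<N = ≤-<-trans (last-length facty) tps<N
      s≺ty : s ≺ (c ∷ r ++ s)
      s≺ty = Below.suffix-≺ ih ≤-refl ty<N gty refl (λ ()) gs
      f≡ : (p′ ++ (y₀ ++ c ∷ r)) ++ s ≡ (p′ ++ y₀) ++ (c ∷ r ++ s)
      f≡ = begin
        (p′ ++ (y₀ ++ c ∷ r)) ++ s   ≡⟨ ++-assoc p′ (y₀ ++ c ∷ r) s ⟩
        p′ ++ ((y₀ ++ c ∷ r) ++ s)   ≡⟨ cong (p′ ++_) (++-assoc y₀ (c ∷ r) s) ⟩
        p′ ++ (y₀ ++ c ∷ r ++ s)     ≡⟨ ++-assoc p′ y₀ (c ∷ r ++ s) ⟨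
        (p′ ++ y₀) ++ (c ∷ r ++ s)   ∎
        where open ≡-Reasoning
      shorter-prefix : length (p′ ++ y₀) ≤ M
      shorter-prefix = ≤-pred (<-≤-trans
        (subst (λ z → length (p′ ++ y₀) < length z) (++-assoc p′ y₀ (c ∷ r)) (length-++-<ˡ (p′ ++ y₀) (λ ())))
        lp)
      ty≺f : (c ∷ r ++ s) ≺ ((p′ ++ (y₀ ++ c ∷ r)) ++ s)
      ty≺f = ih′ shorter-prefix lt gf f≡ (λ e → p′≢[] (++-conicalˡ p′ y₀ e)) gty

  suffix-≺-by-fact : ∀ {N M p s tp} → Below N → SuffixesSmaller (suc N) M →
                     length p ≤ suc M → length (p ++ s) < suc N → G (p ++ s) → G s →
                     Fact p tp → ¬ ¬ (s ≺ (p ++ s))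
  suffix-≺-by-fact _ _ _ _ gps gs fact@(single gtp refl) s⊀ps =
    s⊀ps (≺-trans gs gtp gps (last-factor-≻ gps fact gs) (prefix gtp gs gps))
  suffix-≺-by-fact {s = s} ih ih′ lp lt gps gs fact@(extend {t = tp} fact′ gtp _ refl) s⊀ps =
    fact-exists (λ e → G-nonempty gtp (++-conicalˡ tp s e)) λ (_ , facty) →
      s⊀ps (suffix-≺-extend ih ih′ lp lt tps<N gps p′≢[] gtp gs (last-factor-≻ gps fact gs) facty)
    where
      p′≢[] = fact-nonempty fact′
      tps<N = <-≤-trans (length-++-<ʳ-assoc _ p′≢[]) (≤-pred lt)

  suffix-≺-step : ∀ {N} → Below N → ∀ M → SuffixesSmaller (suc N) M
  suffix-≺-step _  zero    {p = []}    _  _  _  _    p≢[] _  = ⊥-elim (p≢[] refl)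
  suffix-≺-step _  zero    {p = _ ∷ _} () _  _  _    _    _
  suffix-≺-step ih (suc M)             lp lt gf refl p≢[] gs =
    ≺-stable gs gf λ s⊀f → fact-exists p≢[] λ (_ , fact) →
      suffix-≺-by-fact ih (suffix-≺-step ih M) lp lt gf gs fact s⊀f

  below : ∀ N → Below N
  below zero    = record { longest-suffix = λ () ; suffix-≺ = λ _ () }
  below (suc N) = record
    { longest-suffix = longest-suffix-step (below N)
    ; suffix-≺       = suffix-≺-step (below N) _
    }

  longest-suffix : ∀ {w t g} → Fact w t → G g → g IsSuffixOf w → g IsSuffixOf t
  longest-suffix = Below.longest-suffix (below _) ≤-refl

  suffix-⪯ : ∀ {w s} → G w → G s → s IsSuffixOf w → s ⪯ w
  suffix-⪯ = suffix-⪯ᴺ (below _) ≤-refl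

  last-factor-unique : ∀ {w t₁ t₂} → Fact w t₁ → Fact w t₂ → t₁ ≡ t₂
  last-factor-unique f₁ f₂ =
    IsSuffixOf-antisym (longest-suffix f₂ (last-in-G f₁) (last-suffix f₁))
                       (longest-suffix f₁ (last-in-G f₂) (last-suffix f₂))

  factors-unique : ∀ {w t₁ t₂} (f₁ : Fact w t₁) (f₂ : Fact w t₂) → factors f₁ ≡ factors f₂
  factors-unique f₁ f₂ with last-factor-unique f₁ f₂
  factors-unique (single _ _) (single _ _) | refl = refl
  factors-unique (single _ refl) (extend {u = u} f₂ _ _ e) | refl =
    ⊥-elim (fact-nonempty f₂ (++-identityˡ-unique u e))
  factors-unique (extend {u = u} f₁ _ _ refl) (single _ e) | refl =
    ⊥-elim (fact-nonempty f₁ (++-identityˡ-unique u (sym e)))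
  factors-unique (extend {u = u₁} f₁ _ _ refl) (extend {u = u₂} {t = t} f₂ _ _ e) | refl
    with ++-cancelʳ t u₂ u₁ (sym e)
  ... | refl = cong (_++ [ t ]) (factors-unique f₁ f₂)

  factorization-unique : ∀ {w fs fs′} → IsGFact G _≺_ w fs → IsGFact G _≺_ w fs′ → fs ≡ fs′
  factorization-unique isg isg′ with IsGFact⇒Fact isg | IsGFact⇒Fact isg′
  ... | _ , f , refl | _ , f′ , refl = factors-unique f f′

  data Mergeable : W → W → Set where
    letter : ∀ {a u} → Mergeable [ a ] u
    merged : ∀ {v₁ v₂ u} → Mergeable v₁ v₂ → G v₂ → v₂ ⪯ u → Mergeable (v₁ ++ v₂) u

  overlap-∉G : ∀ {v x u tx} → G v → G u → v ⪯ u → x IsSuffixOf v → G (x ++ u) → Fact x tx → ⊥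
  overlap-∉G gv gu v⪯u (r , refl) gxu factx with last-suffix factx
  ... | z , refl = ⪯⇒⊁ gv gu v⪯u (≺-⪯-trans gu gtx gv (last-factor-≻ gxu factx gu) tx⪯v)
    where
      gtx = last-in-G factx
      tx⪯v = suffix-⪯ gv gtx (r ++ z , sym (++-assoc r z _))

  mutual
    mergeable-suffix-∉G : ∀ {v u p x} → Mergeable v u → G u → v ≡ p ++ x → p ≢ [] → x ≢ [] →
                          ¬ G (x ++ u)
    mergeable-suffix-∉G letter _ e p≢[] x≢[] _
      with subst (λ z → 2 ≤ length z) (sym e) (2≤length-++ p≢[] x≢[])
    ... | s≤s ()
    mergeable-suffix-∉G {p = p} {x} (merged {v₁} {v₂} m gv₂ v₂⪯u) gu e p≢[] x≢[] gxu
      with ++-split p x v₁ v₂ (sym e)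
    ... | inj₂ (r , _ , v₂≡rx) =
      fact-exists x≢[] λ (_ , factx) → overlap-∉G gv₂ gu v₂⪯u (r , v₂≡rx) gxu factx
    ... | inj₁ ([] , _ , refl) =
      fact-exists x≢[] λ (_ , factx) → overlap-∉G gv₂ gu v₂⪯u ([] , refl) gxu factx
    ... | inj₁ (c ∷ y , refl , refl) =
      fact-exists {c ∷ y ++ v₂} (λ ()) λ (_ , factz) → mergeable-inner-∉G m gv₂ v₂⪯u gu p≢[] gxu factz

    mergeable-inner-∉G : ∀ {p y v₂ u tz} → Mergeable (p ++ y) v₂ → G v₂ → v₂ ⪯ u → G u → p ≢ [] →
                         G ((y ++ v₂) ++ u) → Fact (y ++ v₂) tz → ⊥
    mergeable-inner-∉G {p} {y} {v₂} m gv₂ v₂⪯u gu p≢[] gyvu factz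
      with longest-suffix factz gv₂ (y , refl)
    ... | [] , refl = G-irreducible gyvu factz gu v₂⪯u
    ... | c ∷ r , refl with last-suffix factz
    ... | z₀ , e with ++-cancelʳ v₂ y (z₀ ++ c ∷ r) (trans e (sym (++-assoc z₀ (c ∷ r) v₂)))
    ... | refl = mergeable-suffix-∉G m gv₂ (sym (++-assoc p z₀ (c ∷ r)))
                   (λ e′ → p≢[] (++-conicalˡ p z₀ e′)) (λ ()) (last-in-G factz)

  merge-in-G : ∀ {v u} → Mergeable v u → G v → G u → u ≺ v → G (v ++ u)
  merge-in-G {v} {u} m gv gu u≺v =
    Equivalence.from (charact (v ++ u) (2≤length-++ (G-nonempty gv) (G-nonempty gu))) no-proper-fact
    where
      two-factors-impossible : ∀ {t} (fact : Fact (v ++ u) t) → 2 ≤ length (factors fact) → ⊥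
      two-factors-impossible (single _ _) (s≤s ())
      two-factors-impossible fact@(extend {u = w′} fact′ gt _ e) _ with longest-suffix fact gu (v , refl)
      ... | [] , refl = ⪯⇒⊁ gv gu (G-prefix-⪯-last gv fact) u≺v
      ... | c ∷ r , refl =
        mergeable-suffix-∉G m gu (++-cancelʳ u v (w′ ++ c ∷ r) (trans e (sym (++-assoc w′ (c ∷ r) u))))
          (fact-nonempty fact′) (λ ()) gt
      no-proper-fact : ¬ Σ (List W) λ fs → IsGFact G _≺_ (v ++ u) fs × 2 ≤ length fs
      no-proper-fact (_ , isg , two) with IsGFact⇒Fact isg
      ... | _ , fact , refl = two-factors-impossible fact two

  mergeable-mono : ∀ {x v v′} → Mergeable x v → G v → G v′ → v ≺ v′ → Mergeable x v′
  mergeable-mono letter               _  _   _    = letter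
  mergeable-mono (merged m gv₂ v₂⪯v) gv gv′ v≺v′ = merged m gv₂ (inj₁ (⪯-≺-trans gv₂ gv gv′ v₂⪯v v≺v′))

  open Procedure NL

  minimal⇒⪯ : ∀ {u L} → G u → All G L → Minimal u L → All (u ⪯_) L
  minimal⇒⪯ gu gL u-min = All.zipWith (λ (gy , y⊀u) → ⊀⇒⪰ gu gy y⊀u) (gL , u-min)

  minimal? : ∀ {y L} → G y → All G L → Dec (Minimal y L)
  minimal? gy []        = yes []
  minimal? gy (gz ∷ gL) = map′ (λ (p , ps) → p ∷ ps) All.uncons (¬? (≺-dec gz gy) ×-dec minimal? gy gL)

  minimum-exists : ∀ {x xs} → All G (x ∷ xs) → ∃ λ m → m ∈ x ∷ xs × Minimal m (x ∷ xs)
  minimum-exists {x} {[]} (gx ∷ []) = x , here refl , ≺-irrefl gx ∷ []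
  minimum-exists {x} (gx ∷ gxs@(_ ∷ _)) with minimum-exists gxs
  ... | m , m∈ , m-min with ≺-dec gx (All.lookup gxs m∈)
  ... | no  x⊀m = m , there m∈ , x⊀m ∷ m-min
  ... | yes x≺m = x , here refl , ≺-irrefl gx ∷ All.zipWith below-x (gxs , m-min)
    where
      below-x : ∀ {z} → G z × ¬ z ≺ m → ¬ z ≺ x
      below-x (gz , z⊀m) z≺x = z⊀m (≺-trans gz gx (All.lookup gxs m∈) z≺x x≺m)

  record MergePoint (L ys : List W) : Set where
    field
      pre  : List W
      v u  : W
      post : List W
      ys≡  : ys ≡ pre ++ v ∷ u ∷ post
      u-minimal         : Minimal u L
      pre-v-not-minimal : All (λ y → ¬ Minimal y L) (pre ++ [ v ])

  leftmost-merge-point : ∀ {L x xs} → All G L → All G xs → ¬ Minimal x L →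
                         Any (λ y → Minimal y L) xs → MergePoint L (x ∷ xs)
  leftmost-merge-point {xs = []} _ _ _ ()
  leftmost-merge-point {x = x} {y ∷ ys} gL (gy ∷ gys) x-not-min y-or-later with minimal? gy gL
  ... | yes y-min = record
    { pre = [] ; v = x ; u = y ; post = ys ; ys≡ = refl
    ; u-minimal = y-min ; pre-v-not-minimal = x-not-min ∷ [] }
  ... | no y-not-min = record
    { pre = x ∷ pre ; v = v ; u = u ; post = post ; ys≡ = cong (x ∷_) ys≡
    ; u-minimal = u-minimal ; pre-v-not-minimal = x-not-min ∷ pre-v-not-minimal }
    where open MergePoint (leftmost-merge-point gL gys y-not-min (Any.tail y-not-min y-or-later))

  merge-step : ∀ {bs out} → MergePoint bs bs →
               ∃₂ λ bs′ out′ → Step (bs , out) (bs′ , out′) × length bs ≡ suc (length bs′)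
  merge-step {out = out} record { pre = pre ; v = v ; u = u ; post = post ; ys≡ = refl
                                ; u-minimal = u-min ; pre-v-not-minimal = not-min } =
    pre ++ (v ++ u) ∷ post , out , merge u-min not-min , length-merge pre

  step-exists : ∀ {bs out} → All G bs → bs ≢ [] →
                ∃₂ λ bs′ out′ → Step (bs , out) (bs′ , out′) × length bs ≡ suc (length bs′)
  step-exists {[]} _ bs≢[] = ⊥-elim (bs≢[] refl)
  step-exists {b ∷ bs} {out} gbs@(gb ∷ gbs′) _ with minimal? gb gbs
  ... | yes b-min     = bs , out ++ [ b ] , emit b-min , refl
  ... | no  b-not-min = merge-step (leftmost-merge-point gbs gbs′ b-not-min (Any.tail b-not-min some-minimal))
    where
      some-minimal : Any (λ y → Minimal y (b ∷ bs)) (b ∷ bs)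
      some-minimal with minimum-exists gbs
      ... | _ , m∈ , m-min = Any.map (λ { refl → m-min }) m∈

  record Invariant (w : W) (blocks out : List W) : Set where
    field
      blocks-in-G      : All G blocks
      blocks-mergeable : AllPairs Mergeable blocks
      out-in-G         : All G out
      out-sorted       : AllPairs _⪯_ out
      out-⪯-blocks     : All (λ o → All (o ⪯_) blocks) out
      concat-≡         : concat out ++ concat blocks ≡ w

  Invariant-init : ∀ w → Invariant w (map [_] w) []
  Invariant-init w = record
    { blocks-in-G      = map⁺ (All.universal letters w)
    ; blocks-mergeable = letters-mergeable w
    ; out-in-G         = []
    ; out-sorted       = []
    ; out-⪯-blocks     = []
    ; concat-≡         = concat-map-[ w ]
    }
    where
      letters-mergeable : ∀ w → AllPairs Mergeable (map [_] w)
      letters-mergeable []      = []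
      letters-mergeable (_ ∷ w) = map⁺ (All.universal (λ _ → letter) w) ∷ letters-mergeable w

  Invariant-step : ∀ {w bs out bs′ out′} → Invariant w bs out → Step (bs , out) (bs′ , out′) →
                   Invariant w bs′ out′
  Invariant-step {w} inv (emit {b} {bs} {out} (_ ∷ b-min)) = record
    { blocks-in-G      = gbs
    ; blocks-mergeable = AllPairs.tail blocks-mergeable
    ; out-in-G         = ++⁺ out-in-G (gb ∷ [])
    ; out-sorted       = AllPairsₚ.++⁺ out-sorted ([] ∷ []) (All.map (λ o⪯ → All.head o⪯ ∷ []) out-⪯-blocks)
    ; out-⪯-blocks     = ++⁺ (All.map All.tail out-⪯-blocks) (minimal⇒⪯ gb gbs b-min ∷ [])
    ; concat-≡         = begin
        concat (out ++ [ b ]) ++ concat bs       ≡⟨ cong (_++ concat bs) (concat-++ out [ b ]) ⟨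
        (concat out ++ (b ++ [])) ++ concat bs   ≡⟨ ++-assoc (concat out) (b ++ []) (concat bs) ⟩
        concat out ++ ((b ++ []) ++ concat bs)   ≡⟨ cong (λ z → concat out ++ (z ++ concat bs)) (++-identityʳ b) ⟩
        concat out ++ (b ++ concat bs)           ≡⟨ concat-≡ ⟩
        w                                        ∎
    }
    where
      open Invariant inv
      open ≡-Reasoning
      gb  = All.head blocks-in-G
      gbs = All.tail blocks-in-G
  Invariant-step inv (merge {pre} {v} {u} {post} {out} u-min pre-v-not-min) = record
    { blocks-in-G      = All-merge pre blocks-in-G gvu
    ; blocks-mergeable = AllPairs-merge pre blocks-mergeable (λ m → mergeable-mono m gv gvu v≺vu)
                           (All.map (merged mvu gu) (minimal⇒⪯ gu gpost post-min))
    ; out-in-G         = out-in-G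
    ; out-sorted       = out-sorted
    ; out-⪯-blocks     = All.zipWith (λ (go , o⪯) → All-merge pre o⪯ (inj₁ (o≺vu go o⪯)))
                                     (out-in-G , out-⪯-blocks)
    ; concat-≡         = trans (cong (concat out ++_) (concat-merge pre)) concat-≡
    }
    where
      open Invariant inv
      gvupost = ++⁻ʳ pre blocks-in-G
      gv      = All.head gvupost
      gu      = All.head (All.tail gvupost)
      gpost   = All.tail (All.tail gvupost)
      v⊀u      = All.head (++⁻ʳ pre u-min)
      post-min = All.tail (All.tail (++⁻ʳ pre u-min))
      v-not-min = All.head (++⁻ʳ pre pre-v-not-min)
      u≺v : u ≺ v
      u≺v = ⋠⇒≻ gv gu λ { (inj₁ v≺u) → v⊀u v≺u ; (inj₂ refl) → v-not-min u-min }
      mvu : Mergeable v u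
      mvu = All.head (AllPairs.head (AllPairs-++⁻ʳ pre blocks-mergeable))
      gvu  = merge-in-G mvu gv gu u≺v
      v≺vu = prefix gv gu gvu
      o≺vu : ∀ {o} → G o → All (o ⪯_) (pre ++ v ∷ u ∷ post) → o ≺ (v ++ u)
      o≺vu go o⪯ = ⪯-≺-trans go gv gvu (All.head (++⁻ʳ pre o⪯)) v≺vu

  run-exists : ∀ {w} k {bs out} → length bs ≡ k → Invariant w bs out → ∃ (Run bs out)
  run-exists _       {[]}    _   _   = _ , done
  run-exists zero    {_ ∷ _} ()  _
  run-exists (suc k) {_ ∷ _} len inv with step-exists {out = _} (Invariant.blocks-in-G inv) (λ ())
  ... | _ , _ , s , len′ with run-exists k (suc-injective (trans (sym len′) len)) (Invariant-step inv s)
  ... | final , r = final , step s r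

  run-sound : ∀ {w bs out final} → Invariant w bs out → Run bs out final → w ≢ [] →
              IsGFact G _≺_ w final
  run-sound inv (step s r) w≢[] = run-sound (Invariant-step inv s) r w≢[]
  run-sound inv done       w≢[] = record
    { nonempty = λ final≡[] → w≢[] (trans (sym concat-≡) (cong (λ o → concat o ++ []) final≡[]))
    ; inG      = out-in-G
    ; product  = trans (sym (++-identityʳ _)) concat-≡
    ; sorted   = AllPairs⇒Linked out-sorted
    }
    where open Invariant inv

  procedure-terminates : ∀ w → ∃ (Outputs w)
  procedure-terminates w = run-exists _ refl (Invariant-init w)

  output-is-factorization : ∀ {w fs} → w ≢ [] → Outputs w fs → IsGFact G _≺_ w fs
  output-is-factorization {w} w≢[] run = run-sound (Invariant-init w) run w≢[]

theorem3p8 : (n : ℕ) → 2 ≤ n → (NL : NyldonLike n) →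
    let open NyldonLike NL in
    let open Procedure NL in
    (w : Word n) → w ≢ [] →
    Σ (List (Word n)) λ fs →
      IsGFact G _≺_ w fs
      × (∀ fs' → IsGFact G _≺_ w fs' → fs' ≡ fs)
      × Outputs w fs
      × (∀ out → Outputs w out → out ≡ fs)
theorem3p8 n _ NL w w≢[] =
  fs , fs-factorization , (λ _ isg → factorization-unique isg fs-factorization) ,
  run , (λ _ run′ → factorization-unique (output-is-factorization w≢[] run′) fs-factorization)
  where
    open NyldonTheory NL
    fs  = proj₁ (procedure-terminates w)
    run = proj₂ (procedure-terminates w)
    fs-factorization = output-is-factorization w≢[] run
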